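{- Let $t$ be a closed term. (1) For $r\in\{\mathrm{cbn},\mathrm{need}\}$: $t$ is $r$-normal (there is no $u$ with $t\to_r u$) if and only if $\mathrm{normal}(t)$. (2) $t$ is $\mathrm{cbv}$-normal (there is no $u$ with $t\to_{\mathrm{cbv}} u$) if and only if $\mathrm{normal}_{\mathrm{cbv}}(t)$.
   Context: Terms: $t,s ::= x \mid \lambda x.t \mid t\,s \mid t[x\leftarrow s]$, where $t[x\leftarrow s]$ (explicit substitution) binds $x$ in $t$; values $v ::= \lambda x.t$. $\mathrm{fv}(t[x\leftarrow s])=(\mathrm{fv}(t)\setminus\{x\})\cup\mathrm{fv}(s)$; closed means no free variables; terms up to $\alpha$-equivalence. Contexts (one hole $\langle\cdot\rangle$): substitution contexts $S ::= \langle\cdot\rangle \mid S[x\leftarrow t]$; CbN contexts $C ::= \langle\cdot\rangle \mid C\,t \mid C[x\leftarrow t]$; CbV (= weak) contexts $V ::= \langle\cdot\rangle \mid V t \mid V[x\leftarrow t] \mid t V \mid t[x\leftarrow V]$; CbNeed contexts $E ::= \langle\cdot\rangle \mid E\,t \mid E[x\leftarrow t] \mid E\langle\langle x\rangle\rangle[x\leftarrow E']$. $K\langle t\rangle$ is plugging (may capture), $K\langle\langle t\rangle\rangle$ plugging where $K$ does not capture free variables of $t$. Root steps: $S\langle\lambda x.t\rangle s\mapsto_m S\langle t[x\leftarrow s]\rangle$ (variables bound by $S$ disjoint from $\mathrm{fv}(s)$); $C\langle\langle x\rangle\rangle[x\leftarrow t]\mapsto_{e,\mathrm{cbn}} C\langle\langle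 t\rangle\rangle[x\leftarrow t]$; $V\langle\langle x\rangle\rangle[x\leftarrow S\langle v\rangle]\mapsto_{e,\mathrm{cbv}} S\langle V\langle\langle v\rangle\rangle[x\leftarrow v]\rangle$; $E\langle\langle x\rangle\rangle[x\leftarrow S\langle v\rangle]\mapsto_{e,\mathrm{need}} S\langle E\langle\langle v\rangle\rangle[x\leftarrow v]\rangle$ (in the last two, variables bound by $S$ disjoint from the free variables of $V\langle\langle x\rangle\rangle$, resp. $E\langle\langle x\rangle\rangle$). $\to_{\mathrm{cbn}}$ is the closure of $\mapsto_m\cup\mapsto_{e,\mathrm{cbn}}$ under CbN contexts (relating $C\langle t'\rangle$ to $C\langle s'\rangle$ when $t'\mapsto s'$); $\to_{\mathrm{cbv}}$ the closure of $\mapsto_m\cup\mapsto_{e,\mathrm{cbv}}$ under CbV contexts; $\to_{\mathrm{need}}$ the closure of $\mapsto_m\cup\mapsto_{e,\mathrm{need}}$ under CbNeed contexts. $\mathrm{normal}$: least predicate with $\mathrm{normal}(\lambda x.t)$ and $\mathrm{normal}(t)\Rightarrow\mathrm{normal}(t[x\leftarrow s])$. $\mathrm{normal}_{\mathrm{cbv}}$: least predicate with $\mathrm{normal}_{\mathrm{cbv}}(\lambda x.t)$ and ($\mathrm{normal}_{\mathrm{cbv}}(t)$ and $\mathrm{normal}_{\mathrm{cbv}}(s)$) $\Rightarrow\mathrm{normal}_{\mathrm{cbv}}(t[x\leftarrow s])$. -}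

module Defs where

-- Linear substitution calculus (terms with explicit substitutions), in
-- well-scoped de Bruijn form (terms up to alpha-equivalence).
-- Tm n = terms whose free variables are among n variables (Fin n);
-- closed terms are Tm 0.

open import Data.Nat using (ℕ; zero; suc)
open import Data.Fin using (Fin; zero; suc)
open import Data.Product using (∃)
open import Relation.Nullary using (¬_)

data Tm (n : ℕ) : Set where
  var : Fin n → Tm n
  lam : Tm (suc n) → Tm n
  app : Tm n → Tm n → Tm n
  es  : Tm (suc n) → Tm n → Tm n       -- t[x←s]  (x bound in t only)

lift : ∀ {n m} → (Fin n → Fin m) → Fin (suc n) → Fin (suc m)
lift ρ zero    = zero
lift ρ (suc i) = suc (ρ i)

ren : ∀ {n m} → (Fin n → Fin m) → Tm n → Tm m
ren ρ (var i)  = var (ρ i)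
ren ρ (lam t)  = lam (ren (lift ρ) t)
ren ρ (app t s) = app (ren ρ t) (ren ρ s)
ren ρ (es t s) = es (ren (lift ρ) t) (ren ρ s)

-- scope after crossing k binders
infixl 6 _⊕_
_⊕_ : ℕ → ℕ → ℕ
n ⊕ zero  = n
n ⊕ suc k = suc n ⊕ k

wkN : ∀ {n} k → Fin n → Fin (n ⊕ k)
wkN zero    i = i
wkN (suc k) i = wkN k (suc i)

liftN : ∀ {n m} k → (Fin n → Fin m) → Fin (n ⊕ k) → Fin (m ⊕ k)
liftN zero    ρ = ρ
liftN (suc k) ρ = liftN k (lift ρ)

-- Contexts: K : XCtx n k has outer scope n and its hole lies under k binders
-- (hole scope n ⊕ k).  plug = K⟨t⟩ (capturing);  plugNC K t = K⟨⟨t⟩⟩ for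
-- t in the outer scope (K does not capture its free variables).

data SCtx (n : ℕ) : ℕ → Set where
  hole : SCtx n zero
  esL  : ∀ {k} → SCtx (suc n) k → Tm n → SCtx n (suc k)

plugS : ∀ {n k} → SCtx n k → Tm (n ⊕ k) → Tm n
plugS hole      u = u
plugS (esL S t) u = es (plugS S u) t

data CCtx (n : ℕ) : ℕ → Set where
  hole : CCtx n zero
  appL : ∀ {k} → CCtx n k → Tm n → CCtx n k
  esL  : ∀ {k} → CCtx (suc n) k → Tm n → CCtx n (suc k)

plugC : ∀ {n k} → CCtx n k → Tm (n ⊕ k) → Tm n
plugC hole       u = u
plugC (appL C t) u = app (plugC C u) t
plugC (esL C t)  u = es (plugC C u) t

plugNCC : ∀ {n k} → CCtx n k → Tm n → Tm n
plugNCC {k = k} C t = plugC C (ren (wkN k) t)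

data VCtx (n : ℕ) : ℕ → Set where
  hole : VCtx n zero
  appL : ∀ {k} → VCtx n k → Tm n → VCtx n k
  esL  : ∀ {k} → VCtx (suc n) k → Tm n → VCtx n (suc k)
  appR : ∀ {k} → Tm n → VCtx n k → VCtx n k
  esR  : ∀ {k} → Tm (suc n) → VCtx n k → VCtx n k

plugV : ∀ {n k} → VCtx n k → Tm (n ⊕ k) → Tm n
plugV hole       u = u
plugV (appL V t) u = app (plugV V u) t
plugV (esL V t)  u = es (plugV V u) t
plugV (appR t V) u = app t (plugV V u)
plugV (esR t V)  u = es t (plugV V u)

plugNCV : ∀ {n k} → VCtx n k → Tm n → Tm n
plugNCV {k = k} V t = plugV V (ren (wkN k) t)

renV : ∀ {n m k} → (Fin n → Fin m) → VCtx n k → VCtx m k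
renV ρ hole       = hole
renV ρ (appL V t) = appL (renV ρ V) (ren ρ t)
renV ρ (esL V t)  = esL (renV (lift ρ) V) (ren ρ t)
renV ρ (appR t V) = appR (ren ρ t) (renV ρ V)
renV ρ (esR t V)  = esR (ren (lift ρ) t) (renV ρ V)

data ECtx (n : ℕ) : ℕ → Set where
  hole : ECtx n zero
  appL : ∀ {k} → ECtx n k → Tm n → ECtx n k
  esL  : ∀ {k} → ECtx (suc n) k → Tm n → ECtx n (suc k)
  esN  : ∀ {j k} → ECtx (suc n) j → ECtx n k → ECtx n k
    -- esN E E' = E⟨⟨x⟩⟩[x←E'] with x the variable bound by the substitution

mutual
  plugE : ∀ {n k} → ECtx n k → Tm (n ⊕ k) → Tm n
  plugE hole        u = u
  plugE (appL E t)  u = app (plugE E u) t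
  plugE (esL E t)   u = es (plugE E u) t
  plugE (esN E E')  u = es (plugNCE E (var zero)) (plugE E' u)

  plugNCE : ∀ {n k} → ECtx n k → Tm n → Tm n
  plugNCE {k = k} E t = plugE E (ren (wkN k) t)

renE : ∀ {n m k} → (Fin n → Fin m) → ECtx n k → ECtx m k
renE ρ hole       = hole
renE ρ (appL E t) = appL (renE ρ E) (ren ρ t)
renE ρ (esL E t)  = esL (renE (lift ρ) E) (ren ρ t)
renE ρ (esN E E') = esN (renE (lift ρ) E) (renE ρ E')

-- Root steps.  Values are abstractions lam b.
-- S⟨λx.t⟩ s ↦m S⟨t[x←s]⟩
data _↦m_ {n : ℕ} : Tm n → Tm n → Set where
  rm : ∀ {k} (S : SCtx n k) (t : Tm (suc (n ⊕ k))) (s : Tm n) →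
       app (plugS S (lam t)) s ↦m plugS S (es t (ren (wkN k) s))

-- C⟨⟨x⟩⟩[x←t] ↦e,cbn C⟨⟨t⟩⟩[x←t]
data _↦ecbn_ {n : ℕ} : Tm n → Tm n → Set where
  recbn : ∀ {k} (C : CCtx (suc n) k) (t : Tm n) →
          es (plugNCC C (var zero)) t ↦ecbn es (plugNCC C (ren suc t)) t

-- V⟨⟨x⟩⟩[x←S⟨v⟩] ↦e,cbv S⟨V⟨⟨v⟩⟩[x←v]⟩
data _↦ecbv_ {n : ℕ} : Tm n → Tm n → Set where
  recbv : ∀ {j k} (V : VCtx (suc n) j) (S : SCtx n k) (b : Tm (suc (n ⊕ k))) →
          es (plugNCV V (var zero)) (plugS S (lam b))
            ↦ecbv
          plugS S (es (plugNCV (renV (lift (wkN k)) V) (ren suc (lam b))) (lam b))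

-- E⟨⟨x⟩⟩[x←S⟨v⟩] ↦e,need S⟨E⟨⟨v⟩⟩[x←v]⟩
data _↦eneed_ {n : ℕ} : Tm n → Tm n → Set where
  reneed : ∀ {j k} (E : ECtx (suc n) j) (S : SCtx n k) (b : Tm (suc (n ⊕ k))) →
           es (plugNCE E (var zero)) (plugS S (lam b))
             ↦eneed
           plugS S (es (plugNCE (renE (lift (wkN k)) E) (ren suc (lam b))) (lam b))

data _→cbn_ {n : ℕ} : Tm n → Tm n → Set where
  cm : ∀ {k} (C : CCtx n k) {t s} → t ↦m s    → plugC C t →cbn plugC C s
  ce : ∀ {k} (C : CCtx n k) {t s} → t ↦ecbn s → plugC C t →cbn plugC C s

data _→cbv_ {n : ℕ} : Tm n → Tm n → Set where
  vm : ∀ {k} (V : VCtx n k) {t s} → t ↦m s    → plugV V t →cbv plugV V s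
  ve : ∀ {k} (V : VCtx n k) {t s} → t ↦ecbv s → plugV V t →cbv plugV V s

data _→need_ {n : ℕ} : Tm n → Tm n → Set where
  nm : ∀ {k} (E : ECtx n k) {t s} → t ↦m s     → plugE E t →need plugE E s
  ne : ∀ {k} (E : ECtx n k) {t s} → t ↦eneed s → plugE E t →need plugE E s

NormalForm : ∀ {n} → (Tm n → Tm n → Set) → Tm n → Set
NormalForm R t = ¬ ∃ (λ u → R t u)

data normal {n : ℕ} : Tm n → Set where
  nlam : ∀ t → normal (lam t)
  nes  : ∀ {t} s → normal t → normal (es t s)

data normalCbv {n : ℕ} : Tm n → Set where
  vlam : ∀ t → normalCbv (lam t)
  ves  : ∀ {t s} → normalCbv t → normalCbv s → normalCbv (es t s)

module Submission where

-- Soundness (normal ⇒ no step) holds in any scope: the hole of an evaluation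
-- context inside a normal term again holds a normal term, while every redex is
-- an application or a substitution whose body has a variable in evaluation
-- position, and neither is normal.
--
-- Completeness (no step ⇒ normal) rests on a progress lemma, again in any
-- scope: every term is normal, takes a step, or is blocked on a FREE variable
-- sitting in the hole of an evaluation context.  Answers S⟨λx.b⟩ supply the
-- multiplicative redexes and the substituted values; bound variables in
-- evaluation position supply exponential redexes.  For closed terms the third
-- case is impossible, so a term without steps is normal.

open import Defs
open import Data.Nat using (ℕ; zero; suc)
open import Data.Fin using (Fin; zero; suc)
open import Data.Product using (Σ; ∃; _×_; _,_; proj₂)
open import Function.Bundles using (_⇔_; mk⇔)
open import Relation.Binary.PropositionalEquality using (_≡_; refl)
open import Relation.Nullary using (¬_; contradiction)

data Answer {n : ℕ} : Tm n → Set where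
  answer : ∀ {k} (S : SCtx n k) (b : Tm (suc (n ⊕ k))) → Answer (plugS S (lam b))

normal⇒answer : ∀ {n} {t : Tm n} → normal t → Answer t
normal⇒answer (nlam b) = answer hole b
normal⇒answer (nes s p) with normal⇒answer p
... | answer S b = answer (esL S s) b

normalCbv⇒normal : ∀ {n} {t : Tm n} → normalCbv t → normal t
normalCbv⇒normal (vlam b)  = nlam b
normalCbv⇒normal (ves p _) = nes _ (normalCbv⇒normal p)

answer-↦m : ∀ {n} {t : Tm n} → Answer t → (s : Tm n) → ∃ λ u → app t s ↦m u
answer-↦m (answer S b) s = _ , rm S b s

answer-↦eneed : ∀ {n j} (E : ECtx (suc n) j) {s : Tm n} → Answer s →
                ∃ λ u → es (plugNCE E (var zero)) s ↦eneed u
answer-↦eneed E (answer S b) = _ , reneed E S b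

answer-↦ecbv : ∀ {n j} (V : VCtx (suc n) j) {s : Tm n} → Answer s →
               ∃ λ u → es (plugNCV V (var zero)) s ↦ecbv u
answer-↦ecbv V (answer S b) = _ , recbv V S b

normal-in-CbN-hole : ∀ {n k} (C : CCtx n k) {u} → normal (plugC C u) → normal u
normal-in-CbN-hole hole       p         = p
normal-in-CbN-hole (appL C t) ()
normal-in-CbN-hole (esL C t)  (nes _ p) = normal-in-CbN-hole C p

normal-in-need-hole : ∀ {n k} (E : ECtx n k) {u} → normal (plugE E u) → normal u
normal-in-need-hole hole       p         = p
normal-in-need-hole (appL E t) ()
normal-in-need-hole (esL E t)  (nes _ p) = normal-in-need-hole E p
normal-in-need-hole (esN E E') (nes _ p) with normal-in-need-hole E p
... | ()

normalCbv-in-CbV-hole : ∀ {n k} (V : VCtx n k) {u} → normalCbv (plugV V u) → normalCbv u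
normalCbv-in-CbV-hole hole       p         = p
normalCbv-in-CbV-hole (appL V t) ()
normalCbv-in-CbV-hole (appR t V) ()
normalCbv-in-CbV-hole (esL V t)  (ves p _) = normalCbv-in-CbV-hole V p
normalCbv-in-CbV-hole (esR t V)  (ves _ q) = normalCbv-in-CbV-hole V q

normal⇒no-cbn-step : ∀ {n} {t u : Tm n} → normal t → ¬ (t →cbn u)
normal⇒no-cbn-step p (cm C (rm _ _ _)) with normal-in-CbN-hole C p
... | ()
normal⇒no-cbn-step p (ce C (recbn C' _)) with normal-in-CbN-hole C p
... | nes _ q with normal-in-CbN-hole C' q
... | ()

normal⇒no-need-step : ∀ {n} {t u : Tm n} → normal t → ¬ (t →need u)
normal⇒no-need-step p (nm E (rm _ _ _)) with normal-in-need-hole E p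
... | ()
normal⇒no-need-step p (ne E (reneed E' _ _)) with normal-in-need-hole E p
... | nes _ q with normal-in-need-hole E' q
... | ()

normalCbv⇒no-cbv-step : ∀ {n} {t u : Tm n} → normalCbv t → ¬ (t →cbv u)
normalCbv⇒no-cbv-step p (vm V (rm _ _ _)) with normalCbv-in-CbV-hole V p
... | ()
normalCbv⇒no-cbv-step p (ve V (recbv V' _ _)) with normalCbv-in-CbV-hole V p
... | ves q _ with normalCbv-in-CbV-hole V' q
... | ()

→cbn-appL : ∀ {n} {t u : Tm n} s → t →cbn u → app t s →cbn app u s
→cbn-appL s (cm C r) = cm (appL C s) r
→cbn-appL s (ce C r) = ce (appL C s) r

→cbn-esL : ∀ {n} {t u : Tm (suc n)} s → t →cbn u → es t s →cbn es u s
→cbn-esL s (cm C r) = cm (esL C s) r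
→cbn-esL s (ce C r) = ce (esL C s) r

→need-appL : ∀ {n} {t u : Tm n} s → t →need u → app t s →need app u s
→need-appL s (nm E r) = nm (appL E s) r
→need-appL s (ne E r) = ne (appL E s) r

→need-esL : ∀ {n} {t u : Tm (suc n)} s → t →need u → es t s →need es u s
→need-esL s (nm E r) = nm (esL E s) r
→need-esL s (ne E r) = ne (esL E s) r

→need-esN : ∀ {n j} (E : ECtx (suc n) j) {s u : Tm n} →
            s →need u → es (plugNCE E (var zero)) s →need es (plugNCE E (var zero)) u
→need-esN E (nm E' r) = nm (esN E E') r
→need-esN E (ne E' r) = ne (esN E E') r

→cbv-appL : ∀ {n} {t u : Tm n} s → t →cbv u → app t s →cbv app u s
→cbv-appL s (vm V r) = vm (appL V s) r
→cbv-appL s (ve V r) = ve (appL V s) r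

→cbv-esL : ∀ {n} {t u : Tm (suc n)} s → t →cbv u → es t s →cbv es u s
→cbv-esL s (vm V r) = vm (esL V s) r
→cbv-esL s (ve V r) = ve (esL V s) r

→cbv-esR : ∀ {n} t {s u : Tm n} → s →cbv u → es t s →cbv es t u
→cbv-esR t (vm V r) = vm (esR t V) r
→cbv-esR t (ve V r) = ve (esR t V) r

BlockedCbn : ∀ {n} → Fin n → Tm n → Set
BlockedCbn {n} i t = Σ ℕ λ k → Σ (CCtx n k) λ C → t ≡ plugNCC C (var i)

BlockedNeed : ∀ {n} → Fin n → Tm n → Set
BlockedNeed {n} i t = Σ ℕ λ k → Σ (ECtx n k) λ E → t ≡ plugNCE E (var i)

BlockedCbv : ∀ {n} → Fin n → Tm n → Set
BlockedCbv {n} i t = Σ ℕ λ k → Σ (VCtx n k) λ V → t ≡ plugNCV V (var i)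

data Progress {n : ℕ} (Normal : Tm n → Set) (_⟶_ : Tm n → Tm n → Set)
              (Blocked : Fin n → Tm n → Set) (t : Tm n) : Set where
  normal-form : Normal t → Progress Normal _⟶_ Blocked t
  step        : ∀ {u} → t ⟶ u → Progress Normal _⟶_ Blocked t
  blocked     : ∀ i → Blocked i t → Progress Normal _⟶_ Blocked t

progress-cbn : ∀ {n} (t : Tm n) → Progress normal _→cbn_ BlockedCbn t
progress-cbn (var i) = blocked i (_ , hole , refl)
progress-cbn (lam b) = normal-form (nlam b)
progress-cbn (app t s) with progress-cbn t
... | normal-form p             = step (cm hole (proj₂ (answer-↦m (normal⇒answer p) s)))
... | step r                    = step (→cbn-appL s r)
... | blocked i (_ , C , refl)  = blocked i (_ , appL C s , refl)
progress-cbn (es t s) with progress-cbn t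
... | normal-form p                  = normal-form (nes s p)
... | step r                         = step (→cbn-esL s r)
... | blocked zero (_ , C , refl)    = step (ce hole (recbn C s))
... | blocked (suc i) (_ , C , refl) = blocked i (_ , esL C s , refl)

progress-need-needed : ∀ {n j} (E : ECtx (suc n) j) {s : Tm n} →
                       Progress normal _→need_ BlockedNeed s →
                       Progress normal _→need_ BlockedNeed (es (plugNCE E (var zero)) s)
progress-need-needed E (normal-form p)             = step (ne hole (proj₂ (answer-↦eneed E (normal⇒answer p))))
progress-need-needed E (step r)                    = step (→need-esN E r)
progress-need-needed E (blocked i (_ , E' , refl)) = blocked i (_ , esN E E' , refl)

progress-need : ∀ {n} (t : Tm n) → Progress normal _→need_ BlockedNeed t
progress-need (var i) = blocked i (_ , hole , refl)
progress-need (lam b) = normal-form (nlam b)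
progress-need (app t s) with progress-need t
... | normal-form p            = step (nm hole (proj₂ (answer-↦m (normal⇒answer p) s)))
... | step r                   = step (→need-appL s r)
... | blocked i (_ , E , refl) = blocked i (_ , appL E s , refl)
progress-need (es t s) with progress-need t
... | normal-form p                  = normal-form (nes s p)
... | step r                         = step (→need-esL s r)
... | blocked zero (_ , E , refl)    = progress-need-needed E (progress-need s)
... | blocked (suc i) (_ , E , refl) = blocked i (_ , esL E s , refl)

-- In CbV, a substitution t[x←s] whose argument s is not yet normal evaluates
-- (or is blocked) inside s; only a normal s lets the given continuation decide.
progress-cbv-argument : ∀ {n} (t : Tm (suc n)) {s : Tm n} →
                        Progress normalCbv _→cbv_ BlockedCbv s →
                        (normalCbv s → Progress normalCbv _→cbv_ BlockedCbv (es t s)) →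
                        Progress normalCbv _→cbv_ BlockedCbv (es t s)
progress-cbv-argument t (normal-form q)            k = k q
progress-cbv-argument t (step r)                   k = step (→cbv-esR t r)
progress-cbv-argument t (blocked i (_ , V , refl)) k = blocked i (_ , esR t V , refl)

progress-cbv : ∀ {n} (t : Tm n) → Progress normalCbv _→cbv_ BlockedCbv t
progress-cbv (var i) = blocked i (_ , hole , refl)
progress-cbv (lam b) = normal-form (vlam b)
progress-cbv (app t s) with progress-cbv t
... | normal-form p            = step (vm hole (proj₂ (answer-↦m (normal⇒answer (normalCbv⇒normal p)) s)))
... | step r                   = step (→cbv-appL s r)
... | blocked i (_ , V , refl) = blocked i (_ , appL V s , refl)
progress-cbv (es t s) with progress-cbv t
... | normal-form p =
  progress-cbv-argument t (progress-cbv s) (λ q → normal-form (ves p q))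
... | step r = step (→cbv-esL s r)
... | blocked zero (_ , V , refl) =
  progress-cbv-argument t (progress-cbv s)
    (λ q → step (ve hole (proj₂ (answer-↦ecbv V (normal⇒answer (normalCbv⇒normal q))))))
... | blocked (suc i) (_ , V , refl) = blocked i (_ , esL V s , refl)

-- For a closed term, progress together with soundness characterises the
-- terms without steps: no term is blocked, as there are no free variables.

normal-form-characterisation :
  ∀ {Normal : Tm 0 → Set} {_⟶_ : Tm 0 → Tm 0 → Set} {Blocked : Fin 0 → Tm 0 → Set} {t} →
  Progress Normal _⟶_ Blocked t → (∀ {u} → Normal t → ¬ (t ⟶ u)) →
  NormalForm _⟶_ t ⇔ Normal t
normal-form-characterisation {Normal} {_⟶_} {Blocked} {t} prog sound =
  mk⇔ (complete prog) (λ p (_ , r) → sound p r)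
  where
  complete : Progress Normal _⟶_ Blocked t → NormalForm _⟶_ t → Normal t
  complete (normal-form p) nf = p
  complete (step r)        nf = contradiction (_ , r) nf
  complete (blocked () _)  nf

proposition1 : (t : Tm 0) →
    (NormalForm _→cbn_ t ⇔ normal t) ×
    (NormalForm _→need_ t ⇔ normal t) ×
    (NormalForm _→cbv_ t ⇔ normalCbv t)
proposition1 t =
  normal-form-characterisation (progress-cbn t)  normal⇒no-cbn-step ,
  normal-form-characterisation (progress-need t) normal⇒no-need-step ,
  normal-form-characterisation (progress-cbv t)  normalCbv⇒no-cbv-step
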